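{- Let $d\in\mathbb N$ and let $R$ be a Boolean relation that is qfpp-definable over $\Gamma_d=\{(x=0),(x=1),(x\to y)\}\cup\{(\neg x_1\vee\dots\vee\neg x_{d'}) : d'\le d\}$. If the arrow graph $H_R$ contains an edge, then $\{R\}$ proportionally implements $(x=y)$. If $H_R$ is edgeless, then $R$ has a qfpp-definition over $\Gamma_d$ using only assignments and negative clauses, i.e., without using any constraints $(x\to y)$ or $(x=y)$.
   Context: A qfpp-definition of $R\subseteq\{0,1\}^r$ over a set of relations $\Delta$ is an expression $R(x_1,\dots,x_r)\equiv$ a conjunction of constraints from $\Delta$ (and equalities) applied to the variables $x_1,\dots,x_r$, without auxiliary variables. The arrow graph $H_R$ is the directed graph on $\{1,\dots,r\}$ with arc $(i,j)$, $i\ne j$, iff no $t\in R$ has $t[i]=1,t[j]=0$, but some $t\in R$ has $t[i]=t[j]=0$ and some $t\in R$ has $t[i]=t[j]=1$. For a relation $R$, its cost function is $f_R(x)=0$ if $x\in R$ and $1$ otherwise; for a formula $\mathcal F$ (conjunction of constraints), $f_{\mathcal F}$ is the number of violated constraints. A language $\Gamma$ proportionally implements a relation $S$ of arity $r$ if there is a formula $\mathcal F$ over $\Gamma$ on variables $X\cup Y$, $|X|=r$, and an integer $c>0$ with $c\cdot f_S(X)=\min_Y f_{\mathcal F}(X,Y)$ for every $X\in\{0,1\}^r$. -}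

module Defs where

open import Data.Nat using (ℕ; zero; suc; _+_; _*_; _≤_; _<_)
open import Data.Fin using (Fin; zero; suc)
open import Data.Bool using (Bool; true; false; not; _∧_; _∨_; _xor_; if_then_else_)
open import Data.Vec using (Vec; []; _∷_; lookup; map)
open import Data.List using (List)
import Data.List as L
open import Data.Sum using (_⊎_; inj₁; inj₂)
open import Data.Product using (Σ; ∃; _×_; _,_)
open import Relation.Binary.PropositionalEquality using (_≡_; _≢_)
open import Relation.Nullary using (¬_)

BRel : ℕ → Set
BRel r = Vec Bool r → Bool

_∈R_ : {r : ℕ} → Vec Bool r → BRel r → Set
t ∈R R = R t ≡ true

data GammaCon (d r : ℕ) : Set where
  assign0   : Fin r → GammaCon d r
  assign1   : Fin r → GammaCon d r
  imp       : Fin r → Fin r → GammaCon d r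
  equ       : Fin r → Fin r → GammaCon d r
  negClause : (k : ℕ) → k ≤ d → Vec (Fin r) k → GammaCon d r

orV : {k : ℕ} → Vec Bool k → Bool
orV []       = false
orV (b ∷ bs) = b ∨ orV bs

holds : {d r : ℕ} → Vec Bool r → GammaCon d r → Bool
holds x (assign0 i)       = not (lookup x i)
holds x (assign1 i)       = lookup x i
holds x (imp i j)         = not (lookup x i) ∨ lookup x j
holds x (equ i j)         = not (lookup x i xor lookup x j)
holds x (negClause k _ s) = orV (map (λ i → not (lookup x i)) s)

satAll : {d r : ℕ} → Vec Bool r → List (GammaCon d r) → Bool
satAll x L.[]       = true
satAll x (c L.∷ cs) = holds x c ∧ satAll x cs

IsQfppDef : (d : ℕ) {r : ℕ} → BRel r → List (GammaCon d r) → Set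
IsQfppDef d {r} R F = (x : Vec Bool r) → R x ≡ satAll x F

QfppDefinable : (d : ℕ) {r : ℕ} → BRel r → Set
QfppDefinable d R = Σ (List (GammaCon d _)) (λ F → IsQfppDef d R F)

data AssignOrNeg {d r : ℕ} : GammaCon d r → Set where
  a0 : (i : Fin r) → AssignOrNeg (assign0 i)
  a1 : (i : Fin r) → AssignOrNeg (assign1 i)
  nc : (k : ℕ) (p : k ≤ d) (s : Vec (Fin r) k) → AssignOrNeg (negClause k p s)

ArrowArc : {r : ℕ} → BRel r → Fin r → Fin r → Set
ArrowArc {r} R i j =
  (i ≢ j)
  × ((t : Vec Bool r) → t ∈R R → ¬ (lookup t i ≡ true × lookup t j ≡ false))
  × (∃ λ (t : Vec Bool r) → t ∈R R × lookup t i ≡ false × lookup t j ≡ false)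
  × (∃ λ (t : Vec Bool r) → t ∈R R × lookup t i ≡ true × lookup t j ≡ true)

HasEdge : {r : ℕ} → BRel r → Set
HasEdge {r} R = Σ (Fin r) λ i → Σ (Fin r) λ j → ArrowArc R i j

costRel : {r : ℕ} → BRel r → Vec Bool r → ℕ
costRel R x = if R x then 0 else 1

eqRel : BRel 2
eqRel (a ∷ b ∷ []) = not (a xor b)

-- formula over {R}: list of scopes; variables are X (Fin s) ⊎ Y (Fin m)
val : {s m : ℕ} → Vec Bool s → Vec Bool m → Fin s ⊎ Fin m → Bool
val x y (inj₁ i) = lookup x i
val x y (inj₂ j) = lookup y j

costFormula : {r s m : ℕ} → BRel r → List (Vec (Fin s ⊎ Fin m) r)
            → Vec Bool s → Vec Bool m → ℕ
costFormula R L.[]         x y = 0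
costFormula R (sc L.∷ F) x y = costRel R (map (val x y) sc) + costFormula R F x y

PropImplements : {r : ℕ} → BRel r → {s : ℕ} → BRel s → Set
PropImplements {r} R {s} S =
  Σ ℕ λ m → Σ (List (Vec (Fin s ⊎ Fin m) r)) λ F → Σ ℕ λ c →
    (0 < c)
    × ((x : Vec Bool s) →
        ((y : Vec Bool m) → c * costRel S x ≤ costFormula R F x y)
        × (∃ λ (y : Vec Bool m) → costFormula R F x y ≡ c * costRel S x))

-- If (i, j) is an arc of H_R, take the two constraints R(y with x at i and
-- x′ at j) and R(y with x′ at i and x at j), sharing the auxiliary tuple y. For
-- x = x′ both are satisfied by y = a tuple of R that agrees with x at i and j.
-- For x ≠ x′ one of them has 1 at i and 0 at j, so it is always violated, and the
-- other is satisfiable iff R has a tuple with 0 at i and 1 at j: c is 1 or 2.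
--
-- If H_R has no arc, an implication a → b entailed by R is already entailed by
-- the assignments R forces: otherwise R has a tuple with a = 1 and one with
-- b = 0, and entailment turns them into the (1,1)- and (0,0)-tuples making
-- (a, b) an arc. So replacing each (a → b) and (a = b) by the assignments forced
-- on a and b does not change the defined relation.
module Submission where

open import Defs
open import Data.Nat using (ℕ; _+_; _*_; _≤_; z≤n; s≤s)
open import Data.Nat.Properties using (≤-reflexive; +-identityʳ; m≤m+n; m≤n+m)
open import Data.List using (List; []; _∷_; _++_; concatMap)
open import Data.List.Relation.Unary.All using (All; []; _∷_)
import Data.List.Relation.Unary.All as All
open import Data.List.Relation.Unary.All.Properties
  using (++⁺; ++⁻ˡ; ++⁻ʳ; concat⁺; concat⁻; map⁺; map⁻)
open import Data.Product using (Σ; ∃; _×_; _,_; proj₁; proj₂)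
open import Data.Sum using (inj₁; inj₂; _⊎_)
open import Data.Bool using (Bool; true; false; not; _∧_; _∨_; _xor_; if_then_else_)
open import Data.Bool.Properties as Bool using (∧-conicalˡ; ∧-conicalʳ; ⇔→≡)
open import Data.Fin using (Fin)
open import Data.Fin.Patterns using (0F; 1F)
import Data.Fin.Properties as Fin
open import Data.Fin.Subset.Properties using (anySubset?)
open import Data.Vec using (Vec; []; _∷_; lookup; map; tabulate)
open import Data.Vec.Properties
  using (lookup-map; lookup∘tabulate; tabulate∘lookup; tabulate-cong; tabulate-∘)
open import Function using (_∘_)
open import Function.Bundles using (_⇔_; mk⇔; Equivalence)
open import Relation.Binary.PropositionalEquality
  using (_≡_; _≢_; refl; sym; trans; cong; cong₂; subst; module ≡-Reasoning)
open import Relation.Nullary using (¬_; Dec; yes; no; contradiction)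
open import Relation.Nullary.Decidable using (_×-dec_)

open Equivalence using (to; from)

implication-mp : ∀ {p q} → not p ∨ q ≡ true → p ≡ true → q ≡ true
implication-mp h refl = h

implication-mt : ∀ {p q} → not p ∨ q ≡ true → q ≡ false → p ≡ false
implication-mt {false} _ _    = refl
implication-mt {true}  h refl = sym h

xnor⇔implications : ∀ p q → not (p xor q) ≡ true ⇔ (not p ∨ q ≡ true × not q ∨ p ≡ true)
xnor⇔implications false false = mk⇔ (λ _ → refl , refl) (λ _ → refl)
xnor⇔implications false true  = mk⇔ (λ ())            (λ ())
xnor⇔implications true  false = mk⇔ (λ ())            (λ ())
xnor⇔implications true  true  = mk⇔ (λ _ → refl , refl) (λ _ → refl)

costRel-∈ : ∀ {r} (R : BRel r) {t} → t ∈R R → costRel R t ≡ 0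
costRel-∈ R t∈R = cong (if_then 0 else 1) t∈R

costRel-∉ : ∀ {r} (R : BRel r) {t} → ¬ t ∈R R → costRel R t ≡ 1
costRel-∉ R {t} t∉R with R t
... | true  = contradiction refl t∉R
... | false = refl

IsMinimum : {A : Set} → (A → ℕ) → ℕ → Set
IsMinimum f n = (∀ y → n ≤ f y) × ∃ λ y → f y ≡ n

isMinimum-const : ∀ {A : Set} {f : A → ℕ} {n} → (∀ y → f y ≡ n) → A → IsMinimum f n
isMinimum-const f≡n y = (λ y′ → ≤-reflexive (sym (f≡n y′))) , y , f≡n y

module EqualityGadget {r : ℕ} (R : BRel r) {i j : Fin r} (i≢j : i ≢ j) where

  Realised : Bool → Bool → Set
  Realised u v = ∃ λ t → t ∈R R × lookup t i ≡ u × lookup t j ≡ v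

  realised? : ∀ u v → Dec (Realised u v)
  -- Subset r is Vec Bool r, so anySubset? searches all r-tuples.
  realised? u v = anySubset? λ t →
    (R t Bool.≟ true) ×-dec ((lookup t i Bool.≟ u) ×-dec (lookup t j Bool.≟ v))

  Forbidden : Bool → Bool → Set
  Forbidden u v = ∀ t → t ∈R R → ¬ (lookup t i ≡ u × lookup t j ≡ v)

  slot : Fin 2 → Fin 2 → Fin r → Fin 2 ⊎ Fin r
  slot p q k with k Fin.≟ i | k Fin.≟ j
  ... | yes _ | _     = inj₁ p
  ... | no _  | yes _ = inj₁ q
  ... | no _  | no _  = inj₂ k

  slot-i : ∀ p q → slot p q i ≡ inj₁ p
  slot-i p q with i Fin.≟ i | i Fin.≟ j
  ... | yes _   | _ = refl
  ... | no i≢i  | _ = contradiction refl i≢i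

  slot-j : ∀ p q → slot p q j ≡ inj₁ q
  slot-j p q with j Fin.≟ i | j Fin.≟ j
  ... | yes j≡i | _       = contradiction (sym j≡i) i≢j
  ... | no _    | yes _   = refl
  ... | no _    | no j≢j  = contradiction refl j≢j

  scope : Fin 2 → Fin 2 → Vec (Fin 2 ⊎ Fin r) r
  scope p q = tabulate (slot p q)

  plug : Vec Bool 2 → Vec Bool r → Fin 2 → Fin 2 → Vec Bool r
  plug x y p q = map (val x y) (scope p q)

  lookup-plug : ∀ x y p q k → lookup (plug x y p q) k ≡ val x y (slot p q k)
  lookup-plug x y p q k =
    trans (lookup-map k (val x y) (scope p q)) (cong (val x y) (lookup∘tabulate (slot p q) k))

  lookup-plug-i : ∀ x y p q → lookup (plug x y p q) i ≡ lookup x p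
  lookup-plug-i x y p q = trans (lookup-plug x y p q i) (cong (val x y) (slot-i p q))

  lookup-plug-j : ∀ x y p q → lookup (plug x y p q) j ≡ lookup x q
  lookup-plug-j x y p q = trans (lookup-plug x y p q j) (cong (val x y) (slot-j p q))

  plug-filled : ∀ {x t p q} → lookup t i ≡ lookup x p → lookup t j ≡ lookup x q →
    plug x t p q ≡ t
  plug-filled {x} {t} {p} {q} ti tj = begin
    map (val x t) (tabulate (slot p q)) ≡⟨ tabulate-∘ (val x t) (slot p q) ⟨
    tabulate (val x t ∘ slot p q)       ≡⟨ tabulate-cong agree ⟩
    tabulate (lookup t)                 ≡⟨ tabulate∘lookup t ⟩
    t                                   ∎
    where
    open ≡-Reasoning
    agree : ∀ k → val x t (slot p q k) ≡ lookup t k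
    agree k with k Fin.≟ i | k Fin.≟ j
    ... | yes refl | _        = sym ti
    ... | no _     | yes refl = sym tj
    ... | no _     | no _     = refl

  cost-filled : ∀ {x t p q} → t ∈R R → lookup t i ≡ lookup x p → lookup t j ≡ lookup x q →
    costRel R (plug x t p q) ≡ 0
  cost-filled t∈R ti tj = trans (cong (costRel R) (plug-filled ti tj)) (costRel-∈ R t∈R)

  cost-forbidden : ∀ {x p q} → Forbidden (lookup x p) (lookup x q) →
    ∀ y → costRel R (plug x y p q) ≡ 1
  cost-forbidden {x} {p} {q} forbid y =
    costRel-∉ R λ t∈R → forbid _ t∈R (lookup-plug-i x y p q , lookup-plug-j x y p q)

  gadget : List (Vec (Fin 2 ⊎ Fin r) r)
  gadget = scope 0F 1F ∷ scope 1F 0F ∷ []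

  gadget-cost : ∀ {x y m n} → costRel R (plug x y 0F 1F) ≡ m → costRel R (plug x y 1F 0F) ≡ n →
    costFormula R gadget x y ≡ m + n
  gadget-cost m≡ n≡ = cong₂ _+_ m≡ (trans (+-identityʳ _) n≡)

  forbidden⇒1≤gadget-cost : ∀ x y →
    Forbidden (lookup x 0F) (lookup x 1F) ⊎ Forbidden (lookup x 1F) (lookup x 0F) →
    1 ≤ costFormula R gadget x y
  forbidden⇒1≤gadget-cost x y (inj₁ forbid) =
    subst (1 ≤_) (sym (gadget-cost (cost-forbidden forbid y) refl)) (m≤m+n 1 _)
  forbidden⇒1≤gadget-cost x y (inj₂ forbid) =
    subst (1 ≤_) (sym (gadget-cost refl (cost-forbidden forbid y))) (m≤n+m 1 _)

  module _ (forbid10 : Forbidden true false)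
           (t₀₀ : Realised false false) (t₁₁ : Realised true true) where

    equal-inputs : ∀ {a} → Realised a a → IsMinimum (costFormula R gadget (a ∷ a ∷ [])) 0
    equal-inputs (t , t∈R , ti , tj) =
      (λ _ → z≤n) , t , gadget-cost (cost-filled t∈R ti tj) (cost-filled t∈R ti tj)

    minimum-with-01 : Realised false true →
      ∀ x → IsMinimum (costFormula R gadget x) (1 * costRel eqRel x)
    minimum-with-01 _ (false ∷ false ∷ []) = equal-inputs t₀₀
    minimum-with-01 _ (true  ∷ true  ∷ []) = equal-inputs t₁₁
    minimum-with-01 (t , t∈R , ti , tj) x@(true ∷ false ∷ []) =
        (λ y → forbidden⇒1≤gadget-cost x y (inj₁ forbid10))
      , t , gadget-cost (cost-forbidden forbid10 t) (cost-filled t∈R ti tj)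
    minimum-with-01 (t , t∈R , ti , tj) x@(false ∷ true ∷ []) =
        (λ y → forbidden⇒1≤gadget-cost x y (inj₂ forbid10))
      , t , gadget-cost (cost-filled t∈R ti tj) (cost-forbidden forbid10 t)

    minimum-without-01 : Forbidden false true →
      ∀ x → IsMinimum (costFormula R gadget x) (2 * costRel eqRel x)
    minimum-without-01 _ (false ∷ false ∷ []) = equal-inputs t₀₀
    minimum-without-01 _ (true  ∷ true  ∷ []) = equal-inputs t₁₁
    minimum-without-01 forbid01 (true ∷ false ∷ []) = isMinimum-const
      (λ y → gadget-cost (cost-forbidden forbid10 y) (cost-forbidden forbid01 y)) (proj₁ t₀₀)
    minimum-without-01 forbid01 (false ∷ true ∷ []) = isMinimum-const
      (λ y → gadget-cost (cost-forbidden forbid01 y) (cost-forbidden forbid10 y)) (proj₁ t₀₀)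

    implementsEquality : PropImplements R eqRel
    implementsEquality with realised? false true
    ... | yes t₀₁  = r , gadget , 1 , s≤s z≤n , minimum-with-01 t₀₁
    ... | no ∄t₀₁ = r , gadget , 2 , s≤s z≤n ,
      minimum-without-01 λ t t∈R (ti , tj) → ∄t₀₁ (t , t∈R , ti , tj)

arc⇒implementsEquality : ∀ {r} {R : BRel r} {i j} → ArrowArc R i j → PropImplements R eqRel
arc⇒implementsEquality {R = R} (i≢j , forbid10 , t₀₀ , t₁₁) =
  EqualityGadget.implementsEquality R i≢j forbid10 t₀₀ t₁₁

_⊨_ : ∀ {d r} → Vec Bool r → GammaCon d r → Set
x ⊨ c = holds x c ≡ true

satAll⇔All : ∀ {d r} {x : Vec Bool r} (F : List (GammaCon d r)) →
  satAll x F ≡ true ⇔ All (x ⊨_) F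
satAll⇔All F = mk⇔ (satAll⇒All F) All⇒satAll
  where
  satAll⇒All : ∀ F → satAll _ F ≡ true → All (_ ⊨_) F
  satAll⇒All []      _ = []
  satAll⇒All (c ∷ F) h = ∧-conicalˡ _ _ h ∷ satAll⇒All F (∧-conicalʳ _ _ h)
  All⇒satAll : ∀ {F} → All (_ ⊨_) F → satAll _ F ≡ true
  All⇒satAll []       = refl
  All⇒satAll (h ∷ hs) = cong₂ _∧_ h (All⇒satAll hs)

qfppDef⇒models : ∀ {d r} {R : BRel r} {F} → IsQfppDef d R F → ∀ x → x ∈R R ⇔ All (x ⊨_) F
qfppDef⇒models {F = F} def x = mk⇔
  (λ x∈R → to (satAll⇔All F) (trans (sym (def x)) x∈R))
  (λ x⊨F → trans (def x) (from (satAll⇔All F) x⊨F))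

models⇒qfppDef : ∀ {d r} {R : BRel r} {F} → (∀ x → x ∈R R ⇔ All (x ⊨_) F) → IsQfppDef d R F
models⇒qfppDef {F = F} models x = ⇔→≡ (mk⇔
  (λ x∈R → from (satAll⇔All F) (to (models x) x∈R))
  (λ x⊨F → from (models x) (to (satAll⇔All F) x⊨F)))

module ArrowFree {d r : ℕ} (R : BRel r) where

  Entails : GammaCon d r → Set
  Entails c = ∀ t → t ∈R R → t ⊨ c

  Occurs : Bool → Fin r → Set
  Occurs v a = ∃ λ t → t ∈R R × lookup t a ≡ v

  occurs? : ∀ v a → Dec (Occurs v a)
  occurs? v a = anySubset? λ t → (R t Bool.≟ true) ×-dec (lookup t a Bool.≟ v)

  avoid : Bool → Fin r → GammaCon d r
  avoid false = assign1
  avoid true  = assign0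

  avoid-sound : ∀ {t v a} → lookup t a ≢ v → t ⊨ avoid v a
  avoid-sound {t} {false} {a} ≢v with lookup t a
  ... | true  = refl
  ... | false = contradiction refl ≢v
  avoid-sound {t} {true} {a} ≢v with lookup t a
  ... | true  = contradiction refl ≢v
  ... | false = refl

  avoid-violated : ∀ {x v a} → x ⊨ avoid v a → lookup x a ≢ v
  avoid-violated {v = false} x⊨ x≡v = contradiction (trans (sym x⊨) x≡v) λ ()
  avoid-violated {v = true}  x⊨ x≡v = contradiction (subst (λ b → not b ≡ true) x≡v x⊨) λ ()

  exclusion : ∀ {v a} → Dec (Occurs v a) → List (GammaCon d r)
  exclusion         (yes _) = []
  exclusion {v} {a} (no _)  = avoid v a ∷ []

  exclusion-sound : ∀ {t v a} → t ∈R R → (o : Dec (Occurs v a)) → All (t ⊨_) (exclusion o)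
  exclusion-sound _   (yes _) = []
  exclusion-sound t∈R (no ∄)  = avoid-sound (λ t≡v → ∄ (_ , t∈R , t≡v)) ∷ []

  exclusion-occurs : ∀ {x v a} (o : Dec (Occurs v a)) → All (x ⊨_) (exclusion o) →
    lookup x a ≡ v → Occurs v a
  exclusion-occurs (yes o) _          _   = o
  exclusion-occurs (no _)  (x⊨ ∷ []) x≡v = contradiction x≡v (avoid-violated x⊨)

  forced : Fin r → List (GammaCon d r)
  forced a = exclusion (occurs? false a) ++ exclusion (occurs? true a)

  forced-sound : ∀ {t} a → t ∈R R → All (t ⊨_) (forced a)
  forced-sound a t∈R =
    ++⁺ (exclusion-sound t∈R (occurs? false a)) (exclusion-sound t∈R (occurs? true a))

  forced-occurs : ∀ {x a} → All (x ⊨_) (forced a) → ∀ v → lookup x a ≡ v → Occurs v a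
  forced-occurs {a = a} x⊨ false =
    exclusion-occurs (occurs? false a) (++⁻ˡ (exclusion (occurs? false a)) x⊨)
  forced-occurs {a = a} x⊨ true  =
    exclusion-occurs (occurs? true a) (++⁻ʳ (exclusion (occurs? false a)) x⊨)

  forced-assignOrNeg : ∀ a → All AssignOrNeg (forced a)
  forced-assignOrNeg a =
    ++⁺ (exclusion-assignOrNeg (occurs? false a)) (exclusion-assignOrNeg (occurs? true a))
    where
    exclusion-assignOrNeg : ∀ {v} (o : Dec (Occurs v a)) → All AssignOrNeg (exclusion o)
    exclusion-assignOrNeg         (yes _) = []
    exclusion-assignOrNeg {false} (no _)  = a1 a ∷ []
    exclusion-assignOrNeg {true}  (no _)  = a0 a ∷ []

  entailed-imp⇒arc : ∀ {a b} → Entails (imp a b) → a ≢ b →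
    Occurs true a → Occurs false b → ArrowArc R a b
  entailed-imp⇒arc ent a≢b (t₁ , t₁∈R , t₁a) (t₀ , t₀∈R , t₀b) =
      a≢b
    , (λ t t∈R (ta , tb) → contradiction (trans (sym (implication-mp (ent t t∈R) ta)) tb) λ ())
    , (t₀ , t₀∈R , implication-mt (ent t₀ t₀∈R) t₀b , t₀b)
    , (t₁ , t₁∈R , t₁a , implication-mp (ent t₁ t₁∈R) t₁a)

  module _ (arrowFree : ¬ HasEdge R) where

    imp-from-forced : ∀ {x a b} → Entails (imp a b) →
      All (x ⊨_) (forced a) → All (x ⊨_) (forced b) → x ⊨ imp {d} a b
    imp-from-forced {x} {a} {b} ent x⊨a x⊨b with lookup x a in xa | lookup x b in xb
    ... | false | _     = refl
    ... | true  | true  = refl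
    ... | true  | false with a Fin.≟ b
    ...   | yes refl = contradiction (trans (sym xa) xb) λ ()
    ...   | no a≢b   = contradiction
      (a , b , entailed-imp⇒arc ent a≢b (forced-occurs x⊨a true xa) (forced-occurs x⊨b false xb))
      arrowFree

    equ-from-forced : ∀ {x a b} → Entails (equ a b) →
      All (x ⊨_) (forced a) → All (x ⊨_) (forced b) → x ⊨ equ {d} a b
    equ-from-forced {x} {a} {b} ent x⊨a x⊨b =
      from (xnor⇔implications (lookup x a) (lookup x b))
      ( imp-from-forced (λ t t∈R → proj₁ (implications t t∈R)) x⊨a x⊨b
      , imp-from-forced (λ t t∈R → proj₂ (implications t t∈R)) x⊨b x⊨a)
      where
      implications : ∀ t → t ∈R R → t ⊨ imp {d} a b × t ⊨ imp {d} b a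
      implications t t∈R = to (xnor⇔implications (lookup t a) (lookup t b)) (ent t t∈R)

  eliminate : GammaCon d r → List (GammaCon d r)
  eliminate (assign0 a)       = assign0 a ∷ []
  eliminate (assign1 a)       = assign1 a ∷ []
  eliminate (imp a b)         = forced a ++ forced b
  eliminate (equ a b)         = forced a ++ forced b
  eliminate (negClause k p s) = negClause k p s ∷ []

  eliminate-assignOrNeg : ∀ c → All AssignOrNeg (eliminate c)
  eliminate-assignOrNeg (assign0 a)       = a0 a ∷ []
  eliminate-assignOrNeg (assign1 a)       = a1 a ∷ []
  eliminate-assignOrNeg (imp a b)         = ++⁺ (forced-assignOrNeg a) (forced-assignOrNeg b)
  eliminate-assignOrNeg (equ a b)         = ++⁺ (forced-assignOrNeg a) (forced-assignOrNeg b)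
  eliminate-assignOrNeg (negClause k p s) = nc k p s ∷ []

  eliminate-sound : ∀ {t} c → t ∈R R → t ⊨ c → All (t ⊨_) (eliminate c)
  eliminate-sound (assign0 a)       _   t⊨c = t⊨c ∷ []
  eliminate-sound (assign1 a)       _   t⊨c = t⊨c ∷ []
  eliminate-sound (imp a b)         t∈R _   = ++⁺ (forced-sound a t∈R) (forced-sound b t∈R)
  eliminate-sound (equ a b)         t∈R _   = ++⁺ (forced-sound a t∈R) (forced-sound b t∈R)
  eliminate-sound (negClause k p s) _   t⊨c = t⊨c ∷ []

  eliminate-complete : ¬ HasEdge R → ∀ {x} c → Entails c → All (x ⊨_) (eliminate c) → x ⊨ c
  eliminate-complete _ (assign0 a)       _   (x⊨c ∷ []) = x⊨c
  eliminate-complete _ (assign1 a)       _   (x⊨c ∷ []) = x⊨c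
  eliminate-complete arrowFree (imp a b) ent x⊨ =
    imp-from-forced arrowFree ent (++⁻ˡ (forced a) x⊨) (++⁻ʳ (forced a) x⊨)
  eliminate-complete arrowFree (equ a b) ent x⊨ =
    equ-from-forced arrowFree ent (++⁻ˡ (forced a) x⊨) (++⁻ʳ (forced a) x⊨)
  eliminate-complete _ (negClause k p s) _   (x⊨c ∷ []) = x⊨c

  arrowFree-definition : ¬ HasEdge R → ∀ F → IsQfppDef d R F →
    IsQfppDef d R (concatMap eliminate F)
  arrowFree-definition arrowFree F def = models⇒qfppDef λ x → mk⇔
    (λ x∈R → concat⁺ (map⁺ (All.map (λ {c} → eliminate-sound c x∈R) (to (models x) x∈R))))
    (λ x⊨ → from (models x)
      (All.zipWith (λ {c} (ent , x⊨c) → eliminate-complete arrowFree c ent x⊨c)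
                   (entailed , map⁻ (concat⁻ x⊨))))
    where
    models : ∀ x → x ∈R R ⇔ All (x ⊨_) F
    models = qfppDef⇒models def
    entailed : All Entails F
    entailed = All.tabulate λ c∈F t t∈R → All.lookup (to (models t) t∈R) c∈F

proposition5p19 : (d r : ℕ) (R : BRel r) → QfppDefinable d R →
    (HasEdge R → PropImplements R eqRel)
    × (¬ HasEdge R →
        Σ (List (GammaCon d r)) (λ F → IsQfppDef d R F × All AssignOrNeg F))
proposition5p19 d r R (F , def) =
    (λ (_ , _ , arc) → arc⇒implementsEquality arc)
  , λ arrowFree →
      concatMap eliminate F
    , arrowFree-definition arrowFree F def
    , concat⁺ (map⁺ (All.universal eliminate-assignOrNeg F))
  where open ArrowFree {d} R
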